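{- The Tree Algorithm is a 2-approximation algorithm for HL$_1$ on trees: for every finite tree $T$, the hub labeling $H$ it returns is a feasible hub labeling of $T$ and satisfies $\sum_{u}|H_u|\le 2\cdot OPT$, where $OPT$ is the minimum of $\sum_u |H'_u|$ over all hub labelings $H'$ of $T$.
   Context: For a tree $T=(V,E)$ and $u,v\in V$, let $P_{uv}$ be the vertex set of the unique $u$–$v$ path ($P_{uu}=\{u\}$). A hub labeling of $T$ is a family $\{H_u\}_{u\in V}$ of subsets of $V$ with $H_u\cap H_v\cap P_{uv}\neq\varnothing$ for all $u,v\in V$ (including $u=v$). HL$_1$ is the problem of minimizing $\sum_{u\in V}|H_u|$. A balanced separator vertex of a tree on $n$ vertices is a vertex $r$ such that every connected component of $T-r$ has at most $n/2$ vertices. The Tree Algorithm, on input a tree $T'$: finds a balanced separator vertex $r$ of $T'$; removes $r$ and recursively computes a hub labeling $H'$ of each connected component of $T'-r$ (no recursive call if $T'$ is a single vertex); returns $H_u=H'_u\cup\{r\}$ for every $u\in T'-r$ and $H_r=\{r\}$. -}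

module Defs where

open import Data.Nat using (ℕ; _≤_; _*_)
open import Data.Fin using (Fin)
open import Data.List using (List; []; _∷_; map; allFin)
open import Data.Nat.ListAction using (sum)
open import Data.List.Relation.Unary.All using (All)
open import Data.List.Relation.Unary.Unique.Propositional using (Unique)
import Data.List.Membership.Propositional as L
open import Data.Fin.Subset using (Subset; _∈_; _∉_; _∪_; ⁅_⁆; ∣_∣; _-_)
open import Data.Product using (Σ; _×_; ∃)
open import Relation.Binary.PropositionalEquality using (_≡_)
open import Relation.Nullary using (¬_)
open import Function.Bundles using (_⇔_)

data Walk {n : ℕ} (E : Fin n → Fin n → Set) : Fin n → Fin n → List (Fin n) → Set where
  single : (u : Fin n) → Walk E u u (u ∷ [])
  cons   : ∀ {u v w vs} → E u v → Walk E v w vs → Walk E u w (u ∷ vs)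

SimplePath : {n : ℕ} (E : Fin n → Fin n → Set) → Fin n → Fin n → List (Fin n) → Set
SimplePath E u v vs = Walk E u v vs × Unique vs

record Tree (n : ℕ) : Set₁ where
  field
    E          : Fin n → Fin n → Set
    sym        : ∀ {u v} → E u v → E v u
    irrefl     : ∀ {u} → ¬ E u u
    connected  : ∀ u v → ∃ λ vs → SimplePath E u v vs
    uniquePath : ∀ {u v vs ws} → SimplePath E u v vs → SimplePath E u v ws → vs ≡ ws

module _ {n : ℕ} (T : Tree n) where
  open Tree T

  OnPath : Fin n → Fin n → Fin n → Set
  OnPath u v w = ∃ λ vs → SimplePath E u v vs × w L.∈ vs

  IsHubLabeling : (Fin n → Subset n) → Set
  IsHubLabeling H = ∀ u v → ∃ λ w → w ∈ H u × w ∈ H v × OnPath u v w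

  ConnectedIn : Subset n → Fin n → Fin n → Set
  ConnectedIn S u v = ∃ λ vs → Walk E u v vs × All (_∈ S) vs

  Component : Subset n → Fin n → Subset n → Set
  Component S r C =
    (∃ λ x → x ∈ C) ×
    (∀ x → x ∈ C → x ∈ S × x ≢r) ×
    (∀ x y → x ∈ C → (y ∈ C ⇔ ConnectedIn (S - r) x y))
    where
      _≢r : Fin n → Set
      x ≢r = ¬ (x ≡ r)

  BalancedSeparator : Subset n → Fin n → Set
  BalancedSeparator S r = r ∈ S × (∀ C → Component S r C → 2 * ∣ C ∣ ≤ ∣ S ∣)

  -- TreeAlg S H: H is a possible output (for some choices of balanced separators)
  -- of the Tree Algorithm run on the subtree induced on S (only H u for u ∈ S
  -- is determined by the run).
  data TreeAlg (S : Subset n) (H : Fin n → Subset n) : Set where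
    step : (r : Fin n) → BalancedSeparator S r →
           H r ≡ ⁅ r ⁆ →
           (∀ C → Component S r C →
              Σ (Fin n → Subset n) λ HC →
                TreeAlg C HC × (∀ u → u ∈ C → H u ≡ HC u ∪ ⁅ r ⁆)) →
           TreeAlg S H

cost : {n : ℕ} → (Fin n → Subset n) → ℕ
cost {n} H = sum (map (λ u → ∣ H u ∣) (allFin n))

-- Fix any hub labeling H′ and put B(S) = Σ_{u∈S} |H′_u ∩ S|. By induction on the run we show
-- Σ_{u∈S} |H_u| ≤ 2 B(S) for the output H on every connected S; B(V) is the cost of H′.
-- Let r be the separator and D = S − r. Induction on the components of D gives
-- Σ_S |H| ≤ 1 + |D| + 2 Σ_{u∈D} |H′_u ∩ comp(u)|. Call u ∈ D bad if H′_u ∩ S leaves comp(u);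
-- then B(S) ≥ 1 + #bad + Σ_{u∈D} |H′_u ∩ comp(u)|, since r ∈ H′_r. Two good vertices u, v have
-- their common hub on the u–v path, inside S, hence in comp(u) and in comp(v); so all good
-- vertices share one component, of size ≤ |S|/2, whence |D| ≤ 1 + 2·#bad.
-- Feasibility: r is a hub of every vertex of S, and two vertices whose path avoids r lie in one
-- component, where the recursive labeling serves them.
module Submission where

open import Defs
open import Data.Nat using (ℕ; zero; suc; _+_; _*_; _≤_; _<_; z≤n; s≤s)
open import Data.Nat.Properties hiding (_≟_)
open import Algebra.Properties.CommutativeSemigroup +-commutativeSemigroup
  using (interchange; x∙yz≈y∙xz)
open import Data.Nat.Induction using (<-wellFounded)
open import Data.Nat.Tactic.RingSolver using (solve-∀)
open import Data.Nat.ListAction using (sum)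
open import Data.Fin using (Fin; zero; suc; _≟_)
open import Data.Fin.Subset
open import Data.Fin.Subset.Properties
open import Data.Vec using ([]; _∷_; here; there)
open import Data.List using (List; []; _∷_; tabulate)
open import Data.List.Properties using (map-tabulate)
open import Data.List.Relation.Unary.All as All using (All; []; _∷_; all?)
open import Data.List.Relation.Unary.All.Properties using (¬Any⇒All¬)
open import Data.List.Relation.Unary.Any using (here; there)
open import Data.List.Relation.Unary.AllPairs using ([]; _∷_)
open import Data.List.Relation.Unary.Unique.Propositional using (Unique)
open import Data.List.Relation.Binary.Subset.Propositional using () renaming (_⊆_ to _⊆ᴸ_)
import Data.List.Membership.Propositional as L
import Data.List.Membership.DecPropositional as DecMembership
open import Data.Product using (Σ; ∃; _×_; _,_; proj₁; proj₂)
open import Data.Sum using (inj₁; inj₂)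
open import Function using (_∘_; id)
open import Function.Bundles using (mk⇔; Equivalence)
open import Induction.WellFounded using (Acc; acc)
open import Relation.Binary.PropositionalEquality
open import Relation.Nullary using (yes; no; does; contradiction)
open import Relation.Unary using (Decidable)

private variable
  n : ℕ

sumOver : Subset n → (Fin n → ℕ) → ℕ
sumOver []            f = 0
sumOver (inside ∷ p)  f = f zero + sumOver p (f ∘ suc)
sumOver (outside ∷ p) f = sumOver p (f ∘ suc)

sumOver-mono : (p : Subset n) {f g : Fin n → ℕ} →
               (∀ {i} → i ∈ p → f i ≤ g i) → sumOver p f ≤ sumOver p g
sumOver-mono []            f≤g = z≤n
sumOver-mono (inside ∷ p)  f≤g = +-mono-≤ (f≤g here) (sumOver-mono p (f≤g ∘ there))
sumOver-mono (outside ∷ p) f≤g = sumOver-mono p (f≤g ∘ there)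

sumOver-+ : (p : Subset n) (f g : Fin n → ℕ) →
            sumOver p (λ i → f i + g i) ≡ sumOver p f + sumOver p g
sumOver-+ []            f g = refl
sumOver-+ (inside ∷ p)  f g rewrite sumOver-+ p (f ∘ suc) (g ∘ suc) =
  interchange (f zero) (g zero) (sumOver p (f ∘ suc)) (sumOver p (g ∘ suc))
sumOver-+ (outside ∷ p) f g = sumOver-+ p (f ∘ suc) (g ∘ suc)

sumOver-* : (p : Subset n) (c : ℕ) (f : Fin n → ℕ) →
            sumOver p (λ i → c * f i) ≡ c * sumOver p f
sumOver-* []            c f = sym (*-zeroʳ c)
sumOver-* (inside ∷ p)  c f rewrite sumOver-* p c (f ∘ suc) =
  sym (*-distribˡ-+ c (f zero) (sumOver p (f ∘ suc)))
sumOver-* (outside ∷ p) c f = sumOver-* p c (f ∘ suc)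

∣p∣≡sumOver-1 : (p : Subset n) → ∣ p ∣ ≡ sumOver p (λ _ → 1)
∣p∣≡sumOver-1 []            = refl
∣p∣≡sumOver-1 (inside ∷ p)  = cong suc (∣p∣≡sumOver-1 p)
∣p∣≡sumOver-1 (outside ∷ p) = ∣p∣≡sumOver-1 p

sumOver-⊥ : (f : Fin n → ℕ) → sumOver ⊥ f ≡ 0
sumOver-⊥ {zero}  f = refl
sumOver-⊥ {suc n} f = sumOver-⊥ (f ∘ suc)

sumOver-⁅⁆ : (i : Fin n) (f : Fin n → ℕ) → sumOver ⁅ i ⁆ f ≡ f i
sumOver-⁅⁆ zero    f = trans (cong (f zero +_) (sumOver-⊥ (f ∘ suc))) (+-identityʳ (f zero))
sumOver-⁅⁆ (suc i) f = sumOver-⁅⁆ i (f ∘ suc)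

sumOver-─ : {p q : Subset n} → q ⊆ p → (f : Fin n → ℕ) →
            sumOver p f ≡ sumOver q f + sumOver (p ─ q) f
sumOver-─ {p = []}          {[]}          q⊆p f = refl
sumOver-─ {p = inside ∷ p}  {inside ∷ q}  q⊆p f
  rewrite sumOver-─ (drop-∷-⊆ q⊆p) (f ∘ suc) =
    sym (+-assoc (f zero) (sumOver q (f ∘ suc)) (sumOver (p ─ q) (f ∘ suc)))
sumOver-─ {p = inside ∷ p}  {outside ∷ q} q⊆p f
  rewrite sumOver-─ (drop-∷-⊆ q⊆p) (f ∘ suc) =
    x∙yz≈y∙xz (f zero) (sumOver q (f ∘ suc)) (sumOver (p ─ q) (f ∘ suc))
sumOver-─ {p = outside ∷ p} {inside ∷ q}  q⊆p f with () ← q⊆p here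
sumOver-─ {p = outside ∷ p} {outside ∷ q} q⊆p f = sumOver-─ (drop-∷-⊆ q⊆p) (f ∘ suc)

sumOver-- : {p : Subset n} {i : Fin n} → i ∈ p → (f : Fin n → ℕ) →
            sumOver p f ≡ f i + sumOver (p - i) f
sumOver-- {p = p} {i} i∈p f =
  trans (sumOver-─ ⁅i⁆⊆p f) (cong (_+ sumOver (p - i) f) (sumOver-⁅⁆ i f))
  where
  ⁅i⁆⊆p : ⁅ i ⁆ ⊆ p
  ⁅i⁆⊆p j∈⁅i⁆ = subst (_∈ p) (sym (x∈⁅y⁆⇒x≡y i j∈⁅i⁆)) i∈p

sumOver-⊤ : (f : Fin n → ℕ) → sumOver ⊤ f ≡ sum (tabulate f)
sumOver-⊤ {zero}  f = refl
sumOver-⊤ {suc n} f = cong (f zero +_) (sumOver-⊤ (f ∘ suc))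

cost≡sumOver-⊤ : (H : Fin n → Subset n) → cost H ≡ sumOver ⊤ (∣_∣ ∘ H)
cost≡sumOver-⊤ H = trans (cong sum (map-tabulate id (∣_∣ ∘ H))) (sym (sumOver-⊤ (∣_∣ ∘ H)))

sumOver-1+ : (p : Subset n) (f : Fin n → ℕ) → sumOver p (λ i → 1 + f i) ≡ ∣ p ∣ + sumOver p f
sumOver-1+ p f = trans (sumOver-+ p (λ _ → 1) f) (cong (_+ sumOver p f) (sym (∣p∣≡sumOver-1 p)))

sumOver-1+* : (p : Subset n) (c : ℕ) (f : Fin n → ℕ) →
              sumOver p (λ i → 1 + c * f i) ≡ ∣ p ∣ + c * sumOver p f
sumOver-1+* p c f = trans (sumOver-1+ p (λ i → c * f i)) (cong (∣ p ∣ +_) (sumOver-* p c f))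

∣p∣≡∣q∣+∣p─q∣ : {p q : Subset n} → q ⊆ p → ∣ p ∣ ≡ ∣ q ∣ + ∣ p ─ q ∣
∣p∣≡∣q∣+∣p─q∣ {p = p} {q} q⊆p = begin
  ∣ p ∣                                           ≡⟨ ∣p∣≡sumOver-1 p ⟩
  sumOver p (λ _ → 1)                             ≡⟨ sumOver-─ q⊆p (λ _ → 1) ⟩
  sumOver q (λ _ → 1) + sumOver (p ─ q) (λ _ → 1) ≡⟨ sym (cong₂ _+_ (∣p∣≡sumOver-1 q) (∣p∣≡sumOver-1 (p ─ q))) ⟩
  ∣ q ∣ + ∣ p ─ q ∣                               ∎
  where open ≡-Reasoning

∣p∣≡1+∣p-x∣ : {p : Subset n} {x : Fin n} → x ∈ p → ∣ p ∣ ≡ suc ∣ p - x ∣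
∣p∣≡1+∣p-x∣ {p = p} {x} x∈p =
  trans (∣p∣≡sumOver-1 p) (trans (sumOver-- x∈p (λ _ → 1)) (cong suc (sym (∣p∣≡sumOver-1 (p - x)))))

∣p∪q∣≤∣p∣+∣q∣ : (p q : Subset n) → ∣ p ∪ q ∣ ≤ ∣ p ∣ + ∣ q ∣
∣p∪q∣≤∣p∣+∣q∣ []            []            = z≤n
∣p∪q∣≤∣p∣+∣q∣ (inside ∷ p)  (inside ∷ q)  = s≤s (≤-trans (∣p∪q∣≤∣p∣+∣q∣ p q) (+-monoʳ-≤ ∣ p ∣ (n≤1+n ∣ q ∣)))
∣p∪q∣≤∣p∣+∣q∣ (inside ∷ p)  (outside ∷ q) = s≤s (∣p∪q∣≤∣p∣+∣q∣ p q)
∣p∪q∣≤∣p∣+∣q∣ (outside ∷ p) (inside ∷ q)  = ≤-trans (s≤s (∣p∪q∣≤∣p∣+∣q∣ p q)) (≤-reflexive (sym (+-suc ∣ p ∣ ∣ q ∣)))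
∣p∪q∣≤∣p∣+∣q∣ (outside ∷ p) (outside ∷ q) = ∣p∪q∣≤∣p∣+∣q∣ p q

x∈p⇒0<∣p∣ : {p : Subset n} {x : Fin n} → x ∈ p → 0 < ∣ p ∣
x∈p⇒0<∣p∣ {n} {p} {x} x∈p = subst (_< ∣ p ∣) (∣⊥∣≡0 n) (p⊂q⇒∣p∣<∣q∣ (⊥⊆ , x , x∈p , ∉⊥))

x∈p─q⇒x∉q : {p q : Subset n} {x : Fin n} → x ∈ p ─ q → x ∉ q
x∈p─q⇒x∉q {p = _ ∷ p} {outside ∷ q} here       ()
x∈p─q⇒x∉q {p = _ ∷ p} {_ ∷ q}       (there x∈) (there x∈q) = x∈p─q⇒x∉q x∈ x∈q

x∈p-y⇒x≢y : {p : Subset n} {x y : Fin n} → x ∈ p - y → x ≢ y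
x∈p-y⇒x≢y {x = x} x∈ refl = x∈p─q⇒x∉q x∈ (x∈⁅x⁆ x)

2*m≤1+n+m⇒m≤1+n : ∀ {m n} → 2 * m ≤ suc (n + m) → m ≤ suc n
2*m≤1+n+m⇒m≤1+n {m} {n} le =
  +-cancelʳ-≤ m m (suc n) (subst (_≤ suc (n + m)) (cong (m +_) (+-identityʳ m)) le)

select : {P : Fin n → Set} → Decidable P → Subset n
select {zero}  P? = []
select {suc n} P? = does (P? zero) ∷ select (P? ∘ suc)

∈-select⁺ : {P : Fin n → Set} (P? : Decidable P) {i : Fin n} → P i → i ∈ select P?
∈-select⁺ P? {zero} Pi with P? zero
... | yes _  = here
... | no ¬Pi = contradiction Pi ¬Pi
∈-select⁺ P? {suc i} Pi = there (∈-select⁺ (P? ∘ suc) Pi)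

∈-select⁻ : {P : Fin n → Set} (P? : Decidable P) {i : Fin n} → i ∈ select P? → P i
∈-select⁻ P? {zero} i∈ with P? zero | i∈
... | yes Pi | _ = Pi
... | no _   | ()
∈-select⁻ P? {suc i} (there i∈) = ∈-select⁻ (P? ∘ suc) i∈

module _ (cl : Fin n → Subset n) (cl-≡ : ∀ {x y} → y ∈ cl x → cl y ≡ cl x) {F K : Fin n → ℕ} where

  private
    classwise : (D : Subset n) → Acc _<_ ∣ D ∣ →
                (∀ {x} → x ∈ D → x ∈ cl x) → (∀ {x} → x ∈ D → cl x ⊆ D) →
                (∀ {x} → x ∈ D → sumOver (cl x) F ≤ sumOver (cl x) K) →
                sumOver D F ≤ sumOver D K
    classwise D (acc smaller) x∈cl cl⊆D bound with nonempty? D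
    ... | no D-empty = sumOver-mono D (λ i∈D → contradiction (_ , i∈D) D-empty)
    ... | yes (x , x∈D) = begin
      sumOver D F                     ≡⟨ sumOver-─ (cl⊆D x∈D) F ⟩
      sumOver (cl x) F + sumOver D′ F ≤⟨ +-mono-≤ (bound x∈D) rest ⟩
      sumOver (cl x) K + sumOver D′ K ≡⟨ sym (sumOver-─ (cl⊆D x∈D) K) ⟩
      sumOver D K                     ∎
      where
      open ≤-Reasoning
      D′ : Subset n
      D′ = D ─ cl x

      D′⊆D : D′ ⊆ D
      D′⊆D = p─q⊆p D (cl x)

      cl⊆D′ : ∀ {y} → y ∈ D′ → cl y ⊆ D′
      cl⊆D′ {y} y∈D′ {z} z∈cl-y = x∈p∧x∉q⇒x∈p─q (cl⊆D (D′⊆D y∈D′) z∈cl-y) z∉cl-x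
        where
        z∉cl-x : z ∉ cl x
        z∉cl-x z∈cl-x = x∈p─q⇒x∉q y∈D′
          (subst (y ∈_) (trans (sym (cl-≡ z∈cl-y)) (cl-≡ z∈cl-x)) (x∈cl (D′⊆D y∈D′)))

      rest : sumOver D′ F ≤ sumOver D′ K
      rest = classwise D′ (smaller (p∩q≢∅⇒∣p─q∣<∣p∣ D (cl x) (x , x∈p∩q⁺ (x∈D , x∈cl x∈D))))
               (x∈cl ∘ D′⊆D) cl⊆D′ (bound ∘ D′⊆D)

  sumOver-≤-classwise : (D : Subset n) →
                        (∀ {x} → x ∈ D → x ∈ cl x) → (∀ {x} → x ∈ D → cl x ⊆ D) →
                        (∀ {x} → x ∈ D → sumOver (cl x) F ≤ sumOver (cl x) K) →
                        sumOver D F ≤ sumOver D K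
  sumOver-≤-classwise D = classwise D (<-wellFounded ∣ D ∣)

module WalkProperties {E : Fin n → Fin n → Set} where
  open DecMembership (_≟_ {n}) using () renaming (_∈?_ to _∈ᴸ?_)

  private variable
    u v x : Fin n
    vs ps : List (Fin n)

  walk-head : Walk E u v vs → u L.∈ vs
  walk-head (single u) = here refl
  walk-head (cons e w) = here refl

  walk-last : Walk E u v vs → v L.∈ vs
  walk-last (single u) = here refl
  walk-last (cons e w) = there (walk-last w)

  simplePath-suffix : Walk E x v ps → Unique ps → u L.∈ ps →
                      ∃ λ qs → SimplePath E u v qs × qs ⊆ᴸ ps
  simplePath-suffix (single x) un (here refl) = _ , (single x , un) , λ q∈ → q∈
  simplePath-suffix (cons e w) un (here refl) = _ , (cons e w , un) , λ q∈ → q∈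
  simplePath-suffix (cons e w) (_ ∷ un) (there u∈) with simplePath-suffix w un u∈
  ... | qs , sp , qs⊆ = qs , sp , there ∘ qs⊆

  walk⇒simplePath : Walk E u v vs → ∃ λ ps → SimplePath E u v ps × ps ⊆ᴸ vs
  walk⇒simplePath (single u) = _ , (single u , [] ∷ []) , λ p∈ → p∈
  walk⇒simplePath (cons {u} e w) with walk⇒simplePath w
  ... | ps , (w′ , un) , ps⊆ with u ∈ᴸ? ps
  ...   | yes u∈ps = let qs , sp , qs⊆ = simplePath-suffix w′ un u∈ps in qs , sp , there ∘ ps⊆ ∘ qs⊆
  ...   | no u∉ps  = u ∷ ps , (cons e w′ , ¬Any⇒All¬ ps u∉ps ∷ un) , λ where
                       (here refl) → here refl
                       (there p∈)  → there (ps⊆ p∈)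

module TreeProperties (T : Tree n) where
  open Tree T renaming (sym to E-sym)
  open WalkProperties {E = E}

  private variable
    u v w x y z : Fin n
    vs ps : List (Fin n)
    S D C : Subset n

  Connected : Subset n → Set
  Connected S = ∀ {u v} → u ∈ S → v ∈ S → ConnectedIn T S u v

  connectedIn-trans : ConnectedIn T S u v → ConnectedIn T S v w → ConnectedIn T S u w
  connectedIn-trans (_ , single u , _) c = c
  connectedIn-trans (_ , cons e w , a ∷ as) c with connectedIn-trans (_ , w , as) c
  ... | _ , w′ , as′ = _ , cons e w′ , a ∷ as′

  connectedIn-sym : ConnectedIn T S u v → ConnectedIn T S v u
  connectedIn-sym (_ , single u , as) = _ , single u , as
  connectedIn-sym (_ , cons {u} e w , a ∷ as) =
    connectedIn-trans (connectedIn-sym (_ , w , as))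
                      (_ , cons (E-sym e) (single u) , All.lookup as (walk-head w) ∷ a ∷ [])

  connectedIn-prefix : Walk E u v vs → All (_∈ S) vs → z L.∈ vs → ConnectedIn T S u z
  connectedIn-prefix (single u) (a ∷ as) (here refl) = _ , single _ , a ∷ []
  connectedIn-prefix (cons e w) (a ∷ as) (here refl) = _ , single _ , a ∷ []
  connectedIn-prefix (cons e w) (a ∷ as) (there z∈) with connectedIn-prefix w as z∈
  ... | _ , w′ , as′ = _ , cons e w′ , a ∷ as′

  path-within : {P : Fin n → Set} → Walk E u v vs → All P vs → SimplePath E u v ps → All P ps
  path-within w Pvs sp with walk⇒simplePath w
  ... | ps , sp′ , ps⊆vs with uniquePath sp sp′
  ... | refl = All.tabulate (All.lookup Pvs ∘ ps⊆vs)

  path : Fin n → Fin n → List (Fin n)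
  path u v = proj₁ (connected u v)

  path-simple : ∀ u v → SimplePath E u v (path u v)
  path-simple u v = proj₂ (connected u v)

  connected-⊤ : Connected ⊤
  connected-⊤ {u} {v} _ _ = path u v , proj₁ (path-simple u v) , All.tabulate (λ _ → ∈⊤)

  path-within-connected : Connected S → u ∈ S → v ∈ S → All (_∈ S) (path u v)
  path-within-connected S-conn u∈S v∈S with S-conn u∈S v∈S
  ... | _ , w , in-S = path-within w in-S (path-simple _ _)

  onPath-within : Connected S → u ∈ S → v ∈ S → OnPath T u v w → w ∈ S
  onPath-within S-conn u∈S v∈S (_ , sp , w∈) with S-conn u∈S v∈S
  ... | _ , walk , in-S = All.lookup (path-within walk in-S sp) w∈

  connectedIn? : (S : Subset n) (u : Fin n) → Decidable (ConnectedIn T S u)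
  connectedIn? S u v with all? (_∈? S) (path u v)
  ... | yes in-S = yes (path u v , proj₁ (path-simple u v) , in-S)
  ... | no ¬in-S = no λ (_ , w , in-S) → ¬in-S (path-within w in-S (path-simple u v))

  hubLabeling-refl : {H : Fin n → Subset n} → IsHubLabeling T H → u ∈ H u
  hubLabeling-refl {u} hl with hl u u
  ... | w , w∈H , _ , _ , sp , w∈path with uniquePath sp (single u , [] ∷ [])
  ... | refl with w∈path
  ... | here refl = w∈H

  componentOf : Subset n → Fin n → Subset n
  componentOf D x = select (connectedIn? D x)

  ∈-componentOf⁺ : ConnectedIn T D x y → y ∈ componentOf D x
  ∈-componentOf⁺ = ∈-select⁺ (connectedIn? _ _)

  ∈-componentOf⁻ : y ∈ componentOf D x → ConnectedIn T D x y
  ∈-componentOf⁻ = ∈-select⁻ (connectedIn? _ _)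

  componentOf-refl : x ∈ D → x ∈ componentOf D x
  componentOf-refl x∈D = ∈-componentOf⁺ (_ , single _ , x∈D ∷ [])

  componentOf-⊆ : componentOf D x ⊆ D
  componentOf-⊆ y∈ with ∈-componentOf⁻ y∈
  ... | _ , w , in-D = All.lookup in-D (walk-last w)

  componentOf-≡ : y ∈ componentOf D x → componentOf D y ≡ componentOf D x
  componentOf-≡ y∈ = ⊆-antisym
    (λ z∈ → ∈-componentOf⁺ (connectedIn-trans (∈-componentOf⁻ y∈) (∈-componentOf⁻ z∈)))
    (λ z∈ → ∈-componentOf⁺ (connectedIn-trans (connectedIn-sym (∈-componentOf⁻ y∈)) (∈-componentOf⁻ z∈)))

  componentOf-isComponent : {r : Fin n} → x ∈ S - r → Component T S r (componentOf (S - r) x)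
  componentOf-isComponent {S = S} {r} x∈D =
    (_ , componentOf-refl x∈D) ,
    (λ y y∈ → p─q⊆p S ⁅ r ⁆ (componentOf-⊆ y∈) , x∈p-y⇒x≢y (componentOf-⊆ y∈)) ,
    λ y z y∈ → mk⇔
      (λ z∈ → connectedIn-trans (connectedIn-sym (∈-componentOf⁻ y∈)) (∈-componentOf⁻ z∈))
      (λ y~z → ∈-componentOf⁺ (connectedIn-trans (∈-componentOf⁻ y∈) y~z))

  component-connected : {r : Fin n} → Component T S r C → Connected C
  component-connected (_ , _ , C-iff) {a} a∈C c∈C with Equivalence.to (C-iff a _ a∈C) c∈C
  ... | vs , w , in-D = vs , w , All.tabulate λ z∈ → Equivalence.from (C-iff a _ a∈C) (connectedIn-prefix w in-D z∈)

module TreeAlgorithm (T : Tree n) where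
  open WalkProperties using (walk-head)
  open TreeProperties T
  open DecMembership (_≟_ {n}) using () renaming (_∈?_ to _∈ᴸ?_)

  ComponentRuns : Subset n → Fin n → (Fin n → Subset n) → Set
  ComponentRuns S r H = ∀ C → Component T S r C →
    Σ (Fin n → Subset n) λ HC → TreeAlg T C HC × (∀ u → u ∈ C → H u ≡ HC u ∪ ⁅ r ⁆)

  CommonHub : (Fin n → Subset n) → Fin n → Fin n → Set
  CommonHub H u v = ∃ λ w → w ∈ H u × w ∈ H v × OnPath T u v w

  HubLabelingOn : Subset n → (Fin n → Subset n) → Set
  HubLabelingOn S H = ∀ {u v} → u ∈ S → v ∈ S → CommonHub H u v

  module Step {S : Subset n} {r : Fin n} {H : Fin n → Subset n}
              (Hr : H r ≡ ⁅ r ⁆) (runs : ComponentRuns S r H) where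

    D : Subset n
    D = S - r

    D⊆S : D ⊆ S
    D⊆S = p─q⊆p S ⁅ r ⁆

    cl : Fin n → Subset n
    cl = componentOf D

    labelsOf : {x : Fin n} → x ∈ D → Fin n → Subset n
    labelsOf x∈D = proj₁ (runs _ (componentOf-isComponent x∈D))

    labels-on-component : {x u : Fin n} (x∈D : x ∈ D) → u ∈ cl x → H u ≡ labelsOf x∈D u ∪ ⁅ r ⁆
    labels-on-component x∈D = proj₂ (proj₂ (runs _ (componentOf-isComponent x∈D))) _

    r∈labels : {u : Fin n} → u ∈ S → r ∈ H u
    r∈labels {u} u∈S with u ≟ r
    ... | yes refl = subst (r ∈_) (sym Hr) (x∈⁅x⁆ r)
    ... | no u≢r   = subst (r ∈_) (sym (labels-on-component u∈D (componentOf-refl u∈D)))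
                           (x∈p∪q⁺ (inj₂ (x∈⁅x⁆ r)))
      where
      u∈D : u ∈ D
      u∈D = x∈p∧x≢y⇒x∈p-y u∈S u≢r

    ComponentHubs : Set
    ComponentHubs = ∀ {x} (x∈D : x ∈ D) → HubLabelingOn (cl x) (labelsOf x∈D)

    hub-via-component : ComponentHubs → {u v : Fin n} → ConnectedIn T D u v → CommonHub H u v
    hub-via-component component-hub {u} {v} u~v@(_ , walk , in-D) =
      let w , w∈u , w∈v , w-on = component-hub u∈D (componentOf-refl u∈D) v∈cl-u
      in  w , lift w∈u (componentOf-refl u∈D) , lift w∈v v∈cl-u , w-on
      where
      u∈D : u ∈ D
      u∈D = All.lookup in-D (walk-head walk)
      v∈cl-u : v ∈ cl u
      v∈cl-u = ∈-componentOf⁺ u~v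
      lift : ∀ {w y} → w ∈ labelsOf u∈D y → y ∈ cl u → w ∈ H y
      lift {w} w∈ y∈ = subst (w ∈_) (sym (labels-on-component u∈D y∈)) (x∈p∪q⁺ (inj₁ w∈))

    step-hub : Connected S → ComponentHubs → HubLabelingOn S H
    step-hub S-conn component-hub {u} {v} u∈S v∈S with r ∈ᴸ? path u v
    ... | yes r∈path = r , r∈labels u∈S , r∈labels v∈S , path u v , path-simple u v , r∈path
    ... | no r∉path  = hub-via-component component-hub (path u v , proj₁ (path-simple u v) , path-in-D)
      where
      path-in-D : All (_∈ D) (path u v)
      path-in-D = All.tabulate λ z∈ →
        x∈p∧x≢y⇒x∈p-y (All.lookup (path-within-connected S-conn u∈S v∈S) z∈) λ { refl → r∉path z∈ }

  treeAlg-hub : {S : Subset n} {H : Fin n → Subset n} → TreeAlg T S H → Connected S → HubLabelingOn S H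
  treeAlg-hub (step r _ Hr runs) S-conn = step-hub S-conn λ x∈D →
    treeAlg-hub (proj₁ (proj₂ (runs _ (componentOf-isComponent x∈D))))
                (component-connected (componentOf-isComponent x∈D))
    where open Step Hr runs

  module Cost {H′ : Fin n → Subset n} (H′-hub : IsHubLabeling T H′) where

    B : Subset n → ℕ
    B S = sumOver S (λ u → ∣ H′ u ∩ S ∣)

    module StepCost {S : Subset n} {r : Fin n} {H : Fin n → Subset n}
                    (S-conn : Connected S) (r∈S : r ∈ S)
                    (balanced : ∀ C → Component T S r C → 2 * ∣ C ∣ ≤ ∣ S ∣)
                    (Hr : H r ≡ ⁅ r ⁆) (runs : ComponentRuns S r H) where
      open Step Hr runs

      ComponentCosts : Set
      ComponentCosts = ∀ {x} (x∈D : x ∈ D) → sumOver (cl x) (∣_∣ ∘ labelsOf x∈D) ≤ 2 * B (cl x)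

      inner : Fin n → ℕ
      inner u = ∣ H′ u ∩ cl u ∣

      Inner : ℕ
      Inner = sumOver D inner

      component-upper : ComponentCosts → ∀ {x} → x ∈ D →
                        sumOver (cl x) (∣_∣ ∘ H) ≤ sumOver (cl x) (λ u → 1 + 2 * inner u)
      component-upper component-cost {x} x∈D = begin
        sumOver (cl x) (∣_∣ ∘ H)                       ≤⟨ sumOver-mono (cl x) label-size ⟩
        sumOver (cl x) (λ u → 1 + ∣ labelsOf x∈D u ∣)  ≡⟨ sumOver-1+ (cl x) (∣_∣ ∘ labelsOf x∈D) ⟩
        ∣ cl x ∣ + sumOver (cl x) (∣_∣ ∘ labelsOf x∈D) ≤⟨ +-monoʳ-≤ ∣ cl x ∣ (component-cost x∈D) ⟩
        ∣ cl x ∣ + 2 * B (cl x)                        ≤⟨ +-monoʳ-≤ ∣ cl x ∣ (*-monoʳ-≤ 2 B≤Inner) ⟩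
        ∣ cl x ∣ + 2 * sumOver (cl x) inner            ≡⟨ sumOver-1+* (cl x) 2 inner ⟨
        sumOver (cl x) (λ u → 1 + 2 * inner u)         ∎
        where
        open ≤-Reasoning
        label-size : ∀ {u} → u ∈ cl x → ∣ H u ∣ ≤ 1 + ∣ labelsOf x∈D u ∣
        label-size {u} u∈ rewrite labels-on-component x∈D u∈ =
          ≤-trans (∣p∪q∣≤∣p∣+∣q∣ (labelsOf x∈D u) ⁅ r ⁆)
                  (≤-reflexive (trans (cong (∣ labelsOf x∈D u ∣ +_) (∣⁅x⁆∣≡1 r)) (+-comm _ 1)))
        B≤Inner : B (cl x) ≤ sumOver (cl x) inner
        B≤Inner = sumOver-mono (cl x) λ {u} u∈ → ≤-reflexive (cong (λ c → ∣ H′ u ∩ c ∣) (sym (componentOf-≡ u∈)))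

      labels-upper : ComponentCosts → sumOver S (∣_∣ ∘ H) ≤ 1 + (∣ D ∣ + 2 * Inner)
      labels-upper component-cost = begin
        sumOver S (∣_∣ ∘ H)                   ≡⟨ sumOver-- r∈S (∣_∣ ∘ H) ⟩
        ∣ H r ∣ + sumOver D (∣_∣ ∘ H)         ≡⟨ cong (λ h → ∣ h ∣ + sumOver D (∣_∣ ∘ H)) Hr ⟩
        ∣ ⁅ r ⁆ ∣ + sumOver D (∣_∣ ∘ H)       ≡⟨ cong (_+ sumOver D (∣_∣ ∘ H)) (∣⁅x⁆∣≡1 r) ⟩
        1 + sumOver D (∣_∣ ∘ H)               ≤⟨ s≤s (sumOver-≤-classwise cl componentOf-≡ D componentOf-refl
                                                    (λ _ → componentOf-⊆) (component-upper component-cost)) ⟩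
        1 + sumOver D (λ u → 1 + 2 * inner u) ≡⟨ cong suc (sumOver-1+* D 2 inner) ⟩
        1 + (∣ D ∣ + 2 * Inner)               ∎
        where open ≤-Reasoning

      leaves? : Decidable λ u → Nonempty (H′ u ∩ S ─ cl u)
      leaves? u = nonempty? (H′ u ∩ S ─ cl u)

      Bad : Subset n
      Bad = D ∩ select leaves?

      Good : Subset n
      Good = D ─ Bad

      Bad⊆D : Bad ⊆ D
      Bad⊆D = p∩q⊆p D _

      Good⊆D : Good ⊆ D
      Good⊆D = p─q⊆p D Bad

      H′∩cl⊆H′∩S : ∀ {u} → H′ u ∩ cl u ⊆ H′ u ∩ S
      H′∩cl⊆H′∩S {u} w∈ with x∈p∩q⁻ (H′ u) (cl u) w∈
      ... | w∈H′ , w∈cl = x∈p∩q⁺ (w∈H′ , D⊆S (componentOf-⊆ w∈cl))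

      inner≤ : ∀ {u} → inner u ≤ ∣ H′ u ∩ S ∣
      inner≤ = p⊆q⇒∣p∣≤∣q∣ H′∩cl⊆H′∩S

      inner<-Bad : ∀ {u} → u ∈ Bad → inner u < ∣ H′ u ∩ S ∣
      inner<-Bad {u} u∈Bad with ∈-select⁻ leaves? (p∩q⊆q D _ u∈Bad)
      ... | w , w∈ = p⊂q⇒∣p∣<∣q∣ (H′∩cl⊆H′∩S , w , p─q⊆p _ _ w∈ , x∈p─q⇒x∉q w∈ ∘ proj₂ ∘ x∈p∩q⁻ (H′ u) (cl u))

      B-lower : 1 + (∣ Bad ∣ + Inner) ≤ B S
      B-lower = begin
        1 + (∣ Bad ∣ + Inner)                                      ≡⟨ cong (λ k → 1 + (∣ Bad ∣ + k)) (sumOver-─ Bad⊆D inner) ⟩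
        1 + (∣ Bad ∣ + (sumOver Bad inner + sumOver Good inner))   ≡⟨ cong suc (+-assoc ∣ Bad ∣ _ _) ⟨
        1 + (∣ Bad ∣ + sumOver Bad inner + sumOver Good inner)     ≡⟨ cong (λ k → 1 + (k + sumOver Good inner)) (sumOver-1+ Bad inner) ⟨
        1 + (sumOver Bad (λ u → 1 + inner u) + sumOver Good inner) ≤⟨ +-mono-≤ (x∈p⇒0<∣p∣ r∈H′r∩S)
                                                                    (+-mono-≤ (sumOver-mono Bad inner<-Bad) (sumOver-mono Good (λ _ → inner≤))) ⟩
        ∣ H′ r ∩ S ∣ + (sumOver Bad h + sumOver Good h)            ≡⟨ cong (∣ H′ r ∩ S ∣ +_) (sumOver-─ Bad⊆D h) ⟨
        ∣ H′ r ∩ S ∣ + sumOver D h                                 ≡⟨ sumOver-- r∈S h ⟨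
        B S                                                        ∎
        where
        open ≤-Reasoning
        h : Fin n → ℕ
        h u = ∣ H′ u ∩ S ∣
        r∈H′r∩S : r ∈ H′ r ∩ S
        r∈H′r∩S = x∈p∩q⁺ (hubLabeling-refl H′-hub , r∈S)

      H′∩S⊆cl-Good : ∀ {u} → u ∈ Good → H′ u ∩ S ⊆ cl u
      H′∩S⊆cl-Good {u} u∈Good {w} w∈ with w ∈? cl u
      ... | yes w∈cl = w∈cl
      ... | no w∉cl  = contradiction
        (x∈p∩q⁺ (Good⊆D u∈Good , ∈-select⁺ leaves? (w , x∈p∧x∉q⇒x∈p─q w∈ w∉cl)))
        (x∈p─q⇒x∉q u∈Good)

      Good⊆cl : ∀ {u} → u ∈ Good → Good ⊆ cl u
      Good⊆cl {u} u∈Good {v} v∈Good =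
        let w , w∈H′u , w∈H′v , w-on = H′-hub u v
            w∈S = onPath-within S-conn (D⊆S (Good⊆D u∈Good)) (D⊆S (Good⊆D v∈Good)) w-on
            w∈cl : ∀ {y} → y ∈ Good → w ∈ H′ y → w ∈ cl y
            w∈cl y∈Good w∈H′y = H′∩S⊆cl-Good y∈Good (x∈p∩q⁺ (w∈H′y , w∈S))
        in  subst (v ∈_) (trans (sym (componentOf-≡ (w∈cl v∈Good w∈H′v))) (componentOf-≡ (w∈cl u∈Good w∈H′u)))
                  (componentOf-refl (Good⊆D v∈Good))

      ∣S∣≡1+∣Bad∣+∣Good∣ : ∣ S ∣ ≡ suc (∣ Bad ∣ + ∣ Good ∣)
      ∣S∣≡1+∣Bad∣+∣Good∣ = trans (∣p∣≡1+∣p-x∣ r∈S) (cong suc (∣p∣≡∣q∣+∣p─q∣ Bad⊆D))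

      ∣Good∣≤1+∣Bad∣ : ∣ Good ∣ ≤ 1 + ∣ Bad ∣
      ∣Good∣≤1+∣Bad∣ with nonempty? Good
      ... | no Good-empty = ≤-trans (≤-reflexive (trans (cong ∣_∣ (Empty-unique Good-empty)) (∣⊥∣≡0 n))) z≤n
      ... | yes (x , x∈Good) = 2*m≤1+n+m⇒m≤1+n (begin
        2 * ∣ Good ∣             ≤⟨ *-monoʳ-≤ 2 (p⊆q⇒∣p∣≤∣q∣ (Good⊆cl x∈Good)) ⟩
        2 * ∣ cl x ∣             ≤⟨ balanced (cl x) (componentOf-isComponent (Good⊆D x∈Good)) ⟩
        ∣ S ∣                    ≡⟨ ∣S∣≡1+∣Bad∣+∣Good∣ ⟩
        suc (∣ Bad ∣ + ∣ Good ∣) ∎)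
        where open ≤-Reasoning

      ∣D∣≤1+2∣Bad∣ : ∣ D ∣ ≤ 1 + 2 * ∣ Bad ∣
      ∣D∣≤1+2∣Bad∣ = begin
        ∣ D ∣                   ≡⟨ ∣p∣≡∣q∣+∣p─q∣ Bad⊆D ⟩
        ∣ Bad ∣ + ∣ Good ∣      ≤⟨ +-monoʳ-≤ ∣ Bad ∣ ∣Good∣≤1+∣Bad∣ ⟩
        ∣ Bad ∣ + (1 + ∣ Bad ∣) ≡⟨ regroup ∣ Bad ∣ ⟩
        1 + 2 * ∣ Bad ∣         ∎
        where
        open ≤-Reasoning
        regroup : ∀ b → b + (1 + b) ≡ 1 + 2 * b
        regroup = solve-∀

      step-cost : ComponentCosts → sumOver S (∣_∣ ∘ H) ≤ 2 * B S
      step-cost component-cost = begin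
        sumOver S (∣_∣ ∘ H)                 ≤⟨ labels-upper component-cost ⟩
        1 + (∣ D ∣ + 2 * Inner)             ≤⟨ +-monoʳ-≤ 1 (+-monoˡ-≤ (2 * Inner) ∣D∣≤1+2∣Bad∣) ⟩
        1 + ((1 + 2 * ∣ Bad ∣) + 2 * Inner) ≡⟨ regroup ∣ Bad ∣ Inner ⟩
        2 * (1 + (∣ Bad ∣ + Inner))         ≤⟨ *-monoʳ-≤ 2 B-lower ⟩
        2 * B S                             ∎
        where
        open ≤-Reasoning
        regroup : ∀ b k → 1 + ((1 + 2 * b) + 2 * k) ≡ 2 * (1 + (b + k))
        regroup = solve-∀

    treeAlg-cost : {S : Subset n} {H : Fin n → Subset n} → TreeAlg T S H → Connected S →
                   sumOver S (∣_∣ ∘ H) ≤ 2 * B S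
    treeAlg-cost (step r (r∈S , balanced) Hr runs) S-conn = step-cost λ x∈D →
      treeAlg-cost (proj₁ (proj₂ (runs _ (componentOf-isComponent x∈D))))
                   (component-connected (componentOf-isComponent x∈D))
      where open StepCost S-conn r∈S balanced Hr runs

mainTheorem2 : (n : ℕ) (T : Tree n) (H : Fin n → Subset n) →
    TreeAlg T ⊤ H →
    IsHubLabeling T H × (∀ H′ → IsHubLabeling T H′ → cost H ≤ 2 * cost H′)
mainTheorem2 n T H run = (λ u v → treeAlg-hub run connected-⊤ ∈⊤ ∈⊤) , cost-bound
  where
  open TreeProperties T
  open TreeAlgorithm T

  cost-bound : ∀ H′ → IsHubLabeling T H′ → cost H ≤ 2 * cost H′
  cost-bound H′ H′-hub = begin
    cost H                   ≡⟨ cost≡sumOver-⊤ H ⟩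
    sumOver ⊤ (∣_∣ ∘ H)      ≤⟨ treeAlg-cost run connected-⊤ ⟩
    2 * B ⊤                  ≤⟨ *-monoʳ-≤ 2 (sumOver-mono ⊤ λ {u} _ → ≤-reflexive (cong ∣_∣ (∩-identityʳ (H′ u)))) ⟩
    2 * sumOver ⊤ (∣_∣ ∘ H′) ≡⟨ cong (2 *_) (cost≡sumOver-⊤ H′) ⟨
    2 * cost H′              ∎
    where
    open ≤-Reasoning
    open Cost H′-hub
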